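{- Let $G=(V,E)$ be a connected graph and let $X\subseteq V$ be the set of cut vertices of $G$. If $\mathrm{evc}(G)=\mathrm{mvc}(G)$, then for every minimum eternal vertex cover class $\mathcal{C}$ of $G$, every configuration of $\mathcal{C}$ is a vertex cover containing all vertices of $X$. Consequently, $\mathrm{evc}_X(G)=\mathrm{mvc}_X(G)=\mathrm{evc}(G)=\mathrm{mvc}(G)$.
   Context: All graphs are finite and simple. $\mathrm{mvc}(G)$ denotes the minimum cardinality of a vertex cover of $G$. Eternal vertex cover game: guards are placed on vertices of $G$, at most one guard per vertex; the set of occupied vertices is a configuration. In each round an attacker chooses an edge $uv$; the defender responds by moving guards simultaneously, each guard either staying put or moving to an adjacent vertex, such that at least one guard moves across the attacked edge, and after the move at most one guard is on each vertex; the number of guards never changes. An eternal vertex cover class of $G$ is a family $\mathcal{C}$ of vertex covers of $G$, all of the same cardinality, such that for every configuration $S\in\mathcal{C}$ and every attacked edge, the attack can be defended by a legal move leading to a configuration in $\mathcal{C}$. The eternal vertex cover number $\mathrm{evc}(G)$ is the minimum cardinality of a configuration of an eternal vertex cover class of $G$; a minimum eternal vertex cover class is an eternal vertex cover class whose configurations have cardinality $\mathrm{evc}(G)$. For $U\subseteq V$, $\mathrm{mvc}_U(G)$ is the minimum cardinality of a vertex cover of $G$ containing all vertices of $U$, and $\mathrm{evc}_U(G)$ is the minimum integer $k$ such that $G$ has an eternal vertex cover class in which every configuration is a vertex cover of cardinality $k$ containing all vertices of $U$. -}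

module Defs where

open import Data.Nat using (ℕ; _≤_)
open import Data.Fin using (Fin)
open import Data.Fin.Subset using (Subset; _∈_; ∣_∣)
open import Data.Product using (Σ; _×_; ∃; ∃-syntax)
open import Data.Sum using (_⊎_)
open import Relation.Binary.PropositionalEquality using (_≡_; _≢_)
open import Relation.Nullary using (¬_)

record Graph (n : ℕ) : Set₁ where
  field
    Adj    : Fin n → Fin n → Set
    sym    : ∀ {u v} → Adj u v → Adj v u
    irrefl : ∀ {u} → ¬ Adj u u
open Graph public

module _ {n : ℕ} (G : Graph n) where

  data Walk : Fin n → Fin n → Set where
    here : ∀ {u} → Walk u u
    step : ∀ {u w v} → Adj G u w → Walk w v → Walk u v

  data WalkAvoid (x : Fin n) : Fin n → Fin n → Set where
    here : ∀ {u} → u ≢ x → WalkAvoid x u u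
    step : ∀ {u w v} → u ≢ x → Adj G u w → WalkAvoid x w v → WalkAvoid x u v

  Connected : Set
  Connected = ∀ u v → Walk u v

  -- x is a cut vertex: deleting x disconnects some pair of vertices that
  -- were connected in G (i.e. the number of components increases)
  CutVertex : Fin n → Set
  CutVertex x = ∃[ u ] ∃[ v ] (u ≢ x × v ≢ x × Walk u v × ¬ WalkAvoid x u v)

  VertexCover : Subset n → Set
  VertexCover S = ∀ u v → Adj G u v → u ∈ S ⊎ v ∈ S

  -- Legal defending move from configuration S to S' for attacked edge uv:
  -- the guard on vertex w moves to f w (staying or moving to a neighbour),
  -- guards end on distinct vertices, S' is the set of new positions, and
  -- some guard crosses the edge uv.
  record Move (S S' : Subset n) (u v : Fin n) : Set where
    field
      f      : Fin n → Fin n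
      local  : ∀ w → w ∈ S → f w ≡ w ⊎ Adj G w (f w)
      inj    : ∀ w w' → w ∈ S → w' ∈ S → f w ≡ f w' → w ≡ w'
      image⇒ : ∀ w → w ∈ S' → ∃[ w' ] (w' ∈ S × f w' ≡ w)
      image⇐ : ∀ w → w ∈ S → f w ∈ S'
      cross  : (u ∈ S × f u ≡ v) ⊎ (v ∈ S × f v ≡ u)

  record EVCClass (k : ℕ) (C : Subset n → Set) : Set where
    field
      cover  : ∀ S → C S → VertexCover S
      size   : ∀ S → C S → ∣ S ∣ ≡ k
      defend : ∀ S → C S → ∀ u v → Adj G u v →
               ∃[ S' ] (C S' × Move S S' u v)

  _⊆ₚ_ : (Fin n → Set) → Subset n → Set
  U ⊆ₚ S = ∀ x → U x → x ∈ S

  IsEvcU : (Fin n → Set) → ℕ → Set₁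
  IsEvcU U k =
    (∃[ C ] (EVCClass k C × (∀ S → C S → U ⊆ₚ S) × ∃[ S ] C S))
    × (∀ k' C S → EVCClass k' C → (∀ S → C S → U ⊆ₚ S) → C S → k ≤ k')

  IsEvc : ℕ → Set₁
  IsEvc k =
    (∃[ C ] (EVCClass k C × ∃[ S ] C S))
    × (∀ k' C S → EVCClass k' C → C S → k ≤ k')

  IsMvcU : (Fin n → Set) → ℕ → Set
  IsMvcU U k =
    (∃[ S ] (VertexCover S × U ⊆ₚ S × ∣ S ∣ ≡ k))
    × (∀ S → VertexCover S → U ⊆ₚ S → k ≤ ∣ S ∣)

  IsMvc : ℕ → Set
  IsMvc k =
    (∃[ S ] (VertexCover S × ∣ S ∣ ≡ k))
    × (∀ S → VertexCover S → k ≤ ∣ S ∣)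

-- If a cut vertex x were unguarded in a configuration S of a class of size mvc(G), pick
-- neighbours y, z of x in different components of G − x and answer the attacks on xy and xz:
-- the guards on y and on z both move to x. Let the guards in the component A of y follow
-- the first answer and all others the second. Each answer keeps its guards inside A or
-- outside A (they never pass through the empty vertex x), so the resulting positions form
-- a vertex cover; but the guards from y and z now collide on x, so it has fewer than
-- mvc(G) vertices.
module Submission where

open import Defs hiding (sym)
open import Data.Nat using (ℕ; zero; suc; _+_; _≤_; _<_; s≤s)
open import Data.Nat.Properties
  using (≤-refl; ≤-reflexive; ≤-trans; +-monoʳ-≤; +-suc; <⇒≱)
open import Data.Fin using (Fin; zero; suc; _≟_)
open import Data.Fin.Subset
  using (Subset; _∈_; _∉_; _⊆_; _∪_; ⁅_⁆; ∣_∣; inside; outside) renaming (⊥ to ∅)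
open import Data.Fin.Subset.Properties
  using (x∈p∪q⁺; x∈p∪q⁻; x∈⁅x⁆; x∈⁅y⁆⇒x≡y; ∣⁅x⁆∣≡1; ∣⊥∣≡0; p⊆q⇒∣p∣≤∣q∣; ∣p∣≤∣x∷p∣; _∈?_)
open import Data.Vec.Base using (here; there; _∷_; [])
open import Data.Product using (_×_; _,_; proj₁; proj₂; ∃-syntax)
open import Data.Sum using (_⊎_; inj₁; inj₂)
open import Data.Empty using (⊥; ⊥-elim)
open import Function using (_∘_)
open import Relation.Nullary using (¬_; Dec; yes; no)
open import Relation.Nullary.Decidable using (¬¬-excluded-middle)
open import Relation.Binary.PropositionalEquality
  using (_≡_; _≢_; refl; sym; trans; cong; subst)

¬¬-Π-Fin : ∀ {m} {P : Fin m → Set} → (∀ i → ¬ ¬ P i) → ¬ ¬ (∀ i → P i)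
¬¬-Π-Fin {zero}  ¬¬P k = k (λ ())
¬¬-Π-Fin {suc m} ¬¬P k =
  ¬¬-Π-Fin (¬¬P ∘ suc) λ Ps → ¬¬P zero λ P₀ → k λ { zero → P₀ ; (suc i) → Ps i }

∣p∪q∣≤∣p∣+∣q∣ : ∀ {m} (p q : Subset m) → ∣ p ∪ q ∣ ≤ ∣ p ∣ + ∣ q ∣
∣p∪q∣≤∣p∣+∣q∣ []            []            = ≤-refl
∣p∪q∣≤∣p∣+∣q∣ (inside ∷ p)  (s ∷ q)       =
  s≤s (≤-trans (∣p∪q∣≤∣p∣+∣q∣ p q) (+-monoʳ-≤ ∣ p ∣ (∣p∣≤∣x∷p∣ s q)))
∣p∪q∣≤∣p∣+∣q∣ (outside ∷ p) (inside ∷ q)  =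
  ≤-trans (s≤s (∣p∪q∣≤∣p∣+∣q∣ p q)) (≤-reflexive (sym (+-suc ∣ p ∣ ∣ q ∣)))
∣p∪q∣≤∣p∣+∣q∣ (outside ∷ p) (outside ∷ q) = ∣p∪q∣≤∣p∣+∣q∣ p q

∣⁅x⁆∪p∣≤1+∣p∣ : ∀ {m} (x : Fin m) (p : Subset m) → ∣ ⁅ x ⁆ ∪ p ∣ ≤ suc ∣ p ∣
∣⁅x⁆∪p∣≤1+∣p∣ x p =
  ≤-trans (∣p∪q∣≤∣p∣+∣q∣ ⁅ x ⁆ p) (≤-reflexive (cong (_+ ∣ p ∣) (∣⁅x⁆∣≡1 x)))

x∈p⇒⁅x⁆∪p⊆p : ∀ {m} {x : Fin m} {p : Subset m} → x ∈ p → ⁅ x ⁆ ∪ p ⊆ p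
x∈p⇒⁅x⁆∪p⊆p {x = x} {p} x∈p y∈ with x∈p∪q⁻ ⁅ x ⁆ p y∈
... | inj₁ y∈⁅x⁆ = subst (_∈ p) (sym (x∈⁅y⁆⇒x≡y x y∈⁅x⁆)) x∈p
... | inj₂ y∈p   = y∈p

image : ∀ {n m} → Subset n → (Fin n → Fin m) → Subset m
image []            g = ∅
image (inside ∷ S)  g = ⁅ g zero ⁆ ∪ image S (g ∘ suc)
image (outside ∷ S) g = image S (g ∘ suc)

∈-image⁺ : ∀ {n m} (S : Subset n) (g : Fin n → Fin m) {w} → w ∈ S → g w ∈ image S g
∈-image⁺ (inside ∷ S)  g here        = x∈p∪q⁺ (inj₁ (x∈⁅x⁆ (g zero)))
∈-image⁺ (inside ∷ S)  g (there w∈S) = x∈p∪q⁺ (inj₂ (∈-image⁺ S (g ∘ suc) w∈S))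
∈-image⁺ (outside ∷ S) g (there w∈S) = ∈-image⁺ S (g ∘ suc) w∈S

∣image∣≤∣S∣ : ∀ {n m} (S : Subset n) (g : Fin n → Fin m) → ∣ image S g ∣ ≤ ∣ S ∣
∣image∣≤∣S∣ {m = m} []   g = ≤-reflexive (∣⊥∣≡0 m)
∣image∣≤∣S∣ (inside ∷ S)  g = ≤-trans (∣⁅x⁆∪p∣≤1+∣p∣ (g zero) _) (s≤s (∣image∣≤∣S∣ S (g ∘ suc)))
∣image∣≤∣S∣ (outside ∷ S) g = ∣image∣≤∣S∣ S (g ∘ suc)

∣image∣<∣S∣ : ∀ {n m} (S : Subset n) (g : Fin n → Fin m) {y z} →
              y ∈ S → z ∈ S → y ≢ z → g y ≡ g z → ∣ image S g ∣ < ∣ S ∣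
∣image∣<∣S∣ (inside ∷ S) g here here y≢z _ = ⊥-elim (y≢z refl)
∣image∣<∣S∣ (inside ∷ S) g here (there z∈S) _ gy≡gz =
  s≤s (≤-trans (p⊆q⇒∣p∣≤∣q∣ (x∈p⇒⁅x⁆∪p⊆p g₀∈)) (∣image∣≤∣S∣ S (g ∘ suc)))
  where g₀∈ = subst (_∈ image S (g ∘ suc)) (sym gy≡gz) (∈-image⁺ S (g ∘ suc) z∈S)
∣image∣<∣S∣ (inside ∷ S) g (there y∈S) here _ gy≡gz =
  s≤s (≤-trans (p⊆q⇒∣p∣≤∣q∣ (x∈p⇒⁅x⁆∪p⊆p g₀∈)) (∣image∣≤∣S∣ S (g ∘ suc)))
  where g₀∈ = subst (_∈ image S (g ∘ suc)) gy≡gz (∈-image⁺ S (g ∘ suc) y∈S)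
∣image∣<∣S∣ (inside ∷ S) g (there y∈S) (there z∈S) y≢z gy≡gz =
  ≤-trans (s≤s (∣⁅x⁆∪p∣≤1+∣p∣ (g zero) _))
          (s≤s (∣image∣<∣S∣ S (g ∘ suc) y∈S z∈S (y≢z ∘ cong suc) gy≡gz))
∣image∣<∣S∣ (outside ∷ S) g (there y∈S) (there z∈S) y≢z gy≡gz =
  ∣image∣<∣S∣ S (g ∘ suc) y∈S z∈S (y≢z ∘ cong suc) gy≡gz

select : ∀ {n} {A : Fin n → Set} → (∀ w → Dec (A w)) → (Fin n → Fin n) → (Fin n → Fin n) →
         Fin n → Fin n
select A? f₁ f₂ w with A? w
... | yes _ = f₁ w
... | no  _ = f₂ w

select-yes : ∀ {n} {A : Fin n → Set} (A? : ∀ w → Dec (A w)) f₁ f₂ {w} →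
             A w → select A? f₁ f₂ w ≡ f₁ w
select-yes A? f₁ f₂ {w} a with A? w
... | yes _ = refl
... | no ¬a = ⊥-elim (¬a a)

select-no : ∀ {n} {A : Fin n → Set} (A? : ∀ w → Dec (A w)) f₁ f₂ {w} →
            ¬ A w → select A? f₁ f₂ w ≡ f₂ w
select-no A? f₁ f₂ {w} ¬a with A? w
... | yes a = ⊥-elim (¬a a)
... | no _  = refl

module _ {n : ℕ} (G : Graph n) where

  Walk-snoc : ∀ {a b c} → Walk G a b → Adj G b c → Walk G a c
  Walk-snoc here         e = step e here
  Walk-snoc (step e′ w) e = step e′ (Walk-snoc w e)

  Walk-reverse : ∀ {a b} → Walk G a b → Walk G b a
  Walk-reverse here       = here
  Walk-reverse (step e w) = Walk-snoc (Walk-reverse w) (Graph.sym G e)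

  module _ {x : Fin n} where

    WalkAvoid-snoc : ∀ {a b c} → WalkAvoid G x a b → Adj G b c → c ≢ x → WalkAvoid G x a c
    WalkAvoid-snoc (here a≢x)      e c≢x = step a≢x e (here c≢x)
    WalkAvoid-snoc (step a≢x e′ w) e c≢x = step a≢x e′ (WalkAvoid-snoc w e c≢x)

    WalkAvoid-reverse : ∀ {a b} → WalkAvoid G x a b → WalkAvoid G x b a
    WalkAvoid-reverse (here a≢x)     = here a≢x
    WalkAvoid-reverse (step a≢x e w) = WalkAvoid-snoc (WalkAvoid-reverse w) (Graph.sym G e) a≢x

    WalkAvoid-append : ∀ {a b c} → WalkAvoid G x a b → WalkAvoid G x b c → WalkAvoid G x a c
    WalkAvoid-append (here _)        w = w
    WalkAvoid-append (step a≢x e w₁) w = step a≢x e (WalkAvoid-append w₁ w)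

    exit-neighbour : ∀ {b a v} → WalkAvoid G x b a → Walk G a v → ¬ WalkAvoid G x b v →
                     ∃[ y ] (WalkAvoid G x b y × Adj G y x)
    exit-neighbour b⇝a here ¬b⇝v = ⊥-elim (¬b⇝v b⇝a)
    exit-neighbour b⇝a (step {w = w} e a⇝v) ¬b⇝v with w ≟ x
    ... | yes refl = _ , b⇝a , e
    ... | no w≢x   = exit-neighbour (WalkAvoid-snoc b⇝a e w≢x) a⇝v ¬b⇝v

  CutVertex⇒separated-neighbours :
    ∀ {x} → CutVertex G x →
    ∃[ y ] ∃[ z ] (Adj G y x × Adj G z x × ¬ WalkAvoid G x y z)
  CutVertex⇒separated-neighbours (u , v , u≢x , v≢x , u⇝v , ¬u⇝v)
    with exit-neighbour (here u≢x) u⇝v ¬u⇝v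
       | exit-neighbour (here v≢x) (Walk-reverse u⇝v) (¬u⇝v ∘ WalkAvoid-reverse)
  ... | y , u⇝y , yx | z , v⇝z , zx =
    y , z , yx , zx ,
    λ y⇝z → ¬u⇝v (WalkAvoid-append u⇝y (WalkAvoid-append y⇝z (WalkAvoid-reverse v⇝z)))

  ClosedAvoiding : Fin n → (Fin n → Set) → Set
  ClosedAvoiding x A = ∀ {p q} → Adj G p q → q ≢ x → A p → A q

  WalkAvoid-closed : ∀ {x} y → ClosedAvoiding x (WalkAvoid G x y)
  WalkAvoid-closed y e q≢x y⇝p = WalkAvoid-snoc y⇝p e q≢x

  module _ {x : Fin n} {A : Fin n → Set} (closed : ClosedAvoiding x A) {f : Fin n → Fin n} where

    closed-source : ∀ {w} → f w ≡ w ⊎ Adj G w (f w) → w ≢ x → A (f w) → A w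
    closed-source (inj₁ fw≡w) w≢x A-fw = subst A fw≡w A-fw
    closed-source (inj₂ adj)  w≢x A-fw = closed (Graph.sym G adj) w≢x A-fw

    closed-target : ∀ {w} → f w ≡ w ⊎ Adj G w (f w) → f w ≢ x → A w → A (f w)
    closed-target (inj₁ fw≡w) fw≢x A-w = subst A (sym fw≡w) A-w
    closed-target (inj₂ adj)  fw≢x A-w = closed adj fw≢x A-w

  module _ {x : Fin n} {A : Fin n → Set} (closed : ClosedAvoiding x A) (A? : ∀ w → Dec (A w))
           {S S₁ S₂ : Subset n} (x∉S : x ∉ S)
           {u₁ v₁ u₂ v₂ : Fin n} (M₁ : Move G S S₁ u₁ v₁) (M₂ : Move G S S₂ u₂ v₂) where

    merged : Fin n → Fin n
    merged = select A? (Move.f M₁) (Move.f M₂)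

    private
      ∈S⇒≢x : ∀ {w} → w ∈ S → w ≢ x
      ∈S⇒≢x w∈S refl = x∉S w∈S

      ∈S₁-inside : ∀ {r} → r ∈ S₁ → A r → r ∈ image S merged
      ∈S₁-inside r∈S₁ A-r with Move.image⇒ M₁ _ r∈S₁
      ... | w , w∈S , refl =
        subst (_∈ image S merged) (select-yes A? _ _ A-w) (∈-image⁺ S merged w∈S)
        where A-w = closed-source closed {Move.f M₁} (Move.local M₁ w w∈S) (∈S⇒≢x w∈S) A-r

      ∈S₂-outside : ∀ {r} → r ∈ S₂ → ¬ A r → r ≢ x → r ∈ image S merged
      ∈S₂-outside r∈S₂ ¬A-r r≢x with Move.image⇒ M₂ _ r∈S₂
      ... | w , w∈S , refl =
        subst (_∈ image S merged) (select-no A? _ _ ¬A-w) (∈-image⁺ S merged w∈S)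
        where ¬A-w = ¬A-r ∘ closed-target closed {Move.f M₂} (Move.local M₂ w w∈S) r≢x

    merged-cover : VertexCover G S₁ → VertexCover G S₂ → x ∈ image S merged →
                   VertexCover G (image S merged)
    merged-cover cov₁ cov₂ x∈T p q e with p ≟ x | q ≟ x
    ... | yes refl | _        = inj₁ x∈T
    ... | no _     | yes refl = inj₂ x∈T
    ... | no p≢x   | no q≢x with A? p
    ...   | yes A-p with cov₁ p q e
    ...     | inj₁ p∈ = inj₁ (∈S₁-inside p∈ A-p)
    ...     | inj₂ q∈ = inj₂ (∈S₁-inside q∈ (closed e q≢x A-p))
    merged-cover cov₁ cov₂ x∈T p q e | no p≢x | no q≢x | no ¬A-p with cov₂ p q e
    ...     | inj₁ p∈ = inj₁ (∈S₂-outside p∈ ¬A-p p≢x)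
    ...     | inj₂ q∈ = inj₂ (∈S₂-outside q∈ (¬A-p ∘ closed (Graph.sym G e) p≢x) q≢x)

  unguarded-endpoint-crosses : ∀ {S S′ x y} → x ∉ S → (M : Move G S S′ x y) → y ∈ S × Move.f M y ≡ x
  unguarded-endpoint-crosses x∉S M with Move.cross M
  ... | inj₁ (x∈S , _) = ⊥-elim (x∉S x∈S)
  ... | inj₂ crossing  = crossing

  smaller-cover : ∀ {x y z S S₁ S₂} → Adj G y x → ¬ WalkAvoid G x y z → x ∉ S →
                  (M₁ : Move G S S₁ x y) (M₂ : Move G S S₂ x z) →
                  VertexCover G S₁ → VertexCover G S₂ → (∀ w → Dec (WalkAvoid G x y w)) →
                  ∃[ T ] (VertexCover G T × ∣ T ∣ < ∣ S ∣)
  smaller-cover {x} {y} {z} {S} yx ¬y⇝z x∉S M₁ M₂ cov₁ cov₂ A? =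
    T , merged-cover closed A? x∉S M₁ M₂ cov₁ cov₂ x∈T ,
    ∣image∣<∣S∣ S g y∈S z∈S y≢z (trans gy≡x (sym gz≡x))
    where
    closed = WalkAvoid-closed y
    g = merged closed A? x∉S M₁ M₂
    T = image S g
    y⇝y : WalkAvoid G x y y
    y⇝y = here λ { refl → Graph.irrefl G yx }
    y≢z : y ≢ z
    y≢z refl = ¬y⇝z y⇝y
    y∈S = proj₁ (unguarded-endpoint-crosses x∉S M₁)
    z∈S = proj₁ (unguarded-endpoint-crosses x∉S M₂)
    gy≡x : g y ≡ x
    gy≡x = trans (select-yes A? _ _ y⇝y) (proj₂ (unguarded-endpoint-crosses x∉S M₁))
    gz≡x : g z ≡ x
    gz≡x = trans (select-no A? _ _ ¬y⇝z) (proj₂ (unguarded-endpoint-crosses x∉S M₂))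
    x∈T : x ∈ T
    x∈T = subst (_∈ T) gy≡x (∈-image⁺ S g y∈S)

  -- Membership in the component of y in G − x is not decidable, but only finitely many
  -- instances of excluded middle are needed to refute an unguarded cut vertex.
  CutVertex-guarded : ∀ {k C} → EVCClass G k C → (∀ T → VertexCover G T → k ≤ ∣ T ∣) →
                      ∀ {S} → C S → ∀ {x} → CutVertex G x → x ∈ S
  CutVertex-guarded cls mvc≥k {S} S∈C {x} cut with x ∈? S
  ... | yes x∈S = x∈S
  ... | no x∉S with CutVertex⇒separated-neighbours cut
  ...   | y , z , yx , zx , ¬y⇝z
        with EVCClass.defend cls S S∈C x y (Graph.sym G yx)
           | EVCClass.defend cls S S∈C x z (Graph.sym G zx)
  ...   | S₁ , S₁∈C , M₁ | S₂ , S₂∈C , M₂ =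
    ⊥-elim (¬¬-Π-Fin (λ _ → ¬¬-excluded-middle) λ A? →
      let T , T-cover , ∣T∣<∣S∣ = smaller-cover yx ¬y⇝z x∉S M₁ M₂
                                    (EVCClass.cover cls S₁ S₁∈C) (EVCClass.cover cls S₂ S₂∈C) A?
      in <⇒≱ ∣T∣<∣S∣ (≤-trans (≤-reflexive (EVCClass.size cls S S∈C)) (mvc≥k T T-cover)))

lemma1 : ∀ {n} (G : Graph n) → Connected G → (k : ℕ) → IsEvc G k → IsMvc G k →
           ((C : Subset n → Set) → EVCClass G k C →
             ∀ S → C S → VertexCover G S × (∀ x → CutVertex G x → x ∈ S))
           × IsEvcU G (CutVertex G) k × IsMvcU G (CutVertex G) k
lemma1 G _ k ((C , cls , S , S∈C) , evc≤) (_ , mvc≥k) =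
  guarded ,
  ((C , cls , (λ S′ S′∈C → proj₂ (guarded C cls S′ S′∈C)) , S , S∈C) ,
   λ k′ C′ S′ cls′ _ S′∈C′ → evc≤ k′ C′ S′ cls′ S′∈C′) ,
  ((S , EVCClass.cover cls S S∈C , proj₂ (guarded C cls S S∈C) , EVCClass.size cls S S∈C) ,
   λ T T-cover _ → mvc≥k T T-cover)
  where
  guarded : (C : Subset _ → Set) → EVCClass G k C →
            ∀ S → C S → VertexCover G S × (∀ x → CutVertex G x → x ∈ S)
  guarded C cls S S∈C =
    EVCClass.cover cls S S∈C , λ x cut → CutVertex-guarded G cls mvc≥k S∈C cut
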